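{- Let $G$ be a finite simple connected graph with $c_{\infty}(G)=1$. Then every block of $G$ has domination number one.
   Context: Game with an unbounded-speed robber: on a graph $G$, a set of cops first choose vertices (several cops may share a vertex), then the robber, knowing their positions, chooses a vertex. Then the cops and the robber move alternately, cops first. In the cops' turn, each cop moves to an adjacent vertex or stays. In the robber's turn, she may move along any path of $G$ starting at her current vertex that contains no vertex currently occupied by a cop, or stay. The cops win if at some point a cop occupies the robber's vertex; the robber wins if she eludes the cops forever. $c_{\infty}(G)$ is the minimum number of cops that guarantees a cop win. A block of a connected graph $G$ is either a maximal 2-connected subgraph of $G$, or an edge of $G$ not contained in any 2-connected subgraph. The domination number of a graph is the minimum size of a set $A$ of vertices such that every vertex lies in $A$ or has a neighbour in $A$. -}

module Defs where

open import Level using (0ℓ)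
open import Data.Nat using (ℕ; _<_; _≤_)
open import Data.Fin using (Fin)
open import Data.Bool using (Bool; T)
open import Data.Vec using (Vec; lookup)
open import Data.Vec.Membership.Propositional using () renaming (_∈_ to _∈ᵥ_; _∉_ to _∉ᵥ_)
open import Data.Fin.Subset using (Subset; ∣_∣) renaming (_∈_ to _∈ₛ_)
open import Data.Product using (Σ; ∃; _×_; _,_)
open import Data.Sum using (_⊎_)
open import Data.Empty using (⊥)
open import Relation.Nullary using (¬_)
open import Relation.Binary.PropositionalEquality using (_≡_; _≢_)

record SimpleGraph (n : ℕ) : Set where
  field
    adj    : Fin n → Fin n → Bool
    sym    : ∀ u v → T (adj u v) → T (adj v u)
    irrefl : ∀ v → ¬ T (adj v v)

module _ {n : ℕ} (G : SimpleGraph n) where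

  Adj : Fin n → Fin n → Set
  Adj u v = T (SimpleGraph.adj G u v)

  data Walk : Fin n → Fin n → Set where
    here : ∀ {u} → Walk u u
    step : ∀ {u w v} → Adj u w → Walk w v → Walk u v

  Connected : Set
  Connected = ∀ u v → Walk u v

  data RobberPath {k : ℕ} (c : Vec (Fin n) k) : Fin n → Fin n → Set where
    stay : ∀ {u} → RobberPath c u u
    step : ∀ {u w v} → u ∉ᵥ c → Adj u w → w ∉ᵥ c → RobberPath c w v → RobberPath c u v

  CopMove : ∀ {k} → Vec (Fin n) k → Vec (Fin n) k → Set
  CopMove c c' = ∀ i → lookup c i ≡ lookup c' i ⊎ Adj (lookup c i) (lookup c' i)

  -- The cops can force capture (in finitely many rounds) from the position
  -- with cops at c, robber at r:
  --   CopsWinFrom      : it is the cops' turn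
  --   CopsWinAfterMove : it is the robber's turn
  data CopsWinFrom {k : ℕ} : Vec (Fin n) k → Fin n → Set
  data CopsWinAfterMove {k : ℕ} : Vec (Fin n) k → Fin n → Set

  data CopsWinFrom {k} where
    caught : ∀ {c r} → r ∈ᵥ c → CopsWinFrom c r
    move   : ∀ {c c' r} → CopMove c c' → CopsWinAfterMove c' r → CopsWinFrom c r

  data CopsWinAfterMove {k} where
    caught : ∀ {c r} → r ∈ᵥ c → CopsWinAfterMove c r
    respond : ∀ {c r} → (∀ r' → RobberPath c r r' → CopsWinFrom c r') → CopsWinAfterMove c r

  CopsWin : ℕ → Set
  CopsWin k = Σ (Vec (Fin n) k) λ c → ∀ r → CopsWinFrom c r

  CopNumberInf≡ : ℕ → Set
  CopNumberInf≡ k = CopsWin k × (∀ j → j < k → ¬ CopsWin j)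

  record Subgraph : Set₁ where
    field
      V     : Fin n → Set
      E     : Fin n → Fin n → Set
      E-adj : ∀ {u v} → E u v → Adj u v
      E-V   : ∀ {u v} → E u v → V u × V v
      E-sym : ∀ {u v} → E u v → E v u

  open Subgraph public

  _⊑_ : Subgraph → Subgraph → Set
  H ⊑ H' = (∀ x → V H x → V H' x) × (∀ x y → E H x y → E H' x y)

  data HWalk (H : Subgraph) (X : Fin n → Set) : Fin n → Fin n → Set where
    here : ∀ {u} → HWalk H X u u
    step : ∀ {u w v} → E H u w → ¬ X w → HWalk H X w v → HWalk H X u v

  TwoConnected : Subgraph → Set
  TwoConnected H =
    (∃ λ a → ∃ λ b → ∃ λ d → V H a × V H b × V H d × a ≢ b × a ≢ d × b ≢ d)
    × (∀ u v → V H u → V H v → HWalk H (λ _ → ⊥) u v)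
    × (∀ x u v → V H u → V H v → u ≢ x → v ≢ x → HWalk H (_≡ x) u v)

  IsEdge : Subgraph → Fin n → Fin n → Set
  IsEdge H u v =
    Adj u v
    × (∀ x → V H x → x ≡ u ⊎ x ≡ v)
    × (∀ x → x ≡ u ⊎ x ≡ v → V H x)
    × (∀ x y → E H x y → (x ≡ u × y ≡ v) ⊎ (x ≡ v × y ≡ u))
    × (∀ x y → (x ≡ u × y ≡ v) ⊎ (x ≡ v × y ≡ u) → E H x y)

  Block : Subgraph → Set₁
  Block H =
    (TwoConnected H × (∀ H' → H ⊑ H' → TwoConnected H' → H' ⊑ H))
    ⊎ (∃ λ u → ∃ λ v → IsEdge H u v × (∀ H' → TwoConnected H' → ¬ E H' u v))

  Dominating : Subgraph → Subset n → Set
  Dominating H A =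
    (∀ x → x ∈ₛ A → V H x)
    × (∀ x → V H x → x ∈ₛ A ⊎ (∃ λ y → y ∈ₛ A × E H x y))

  DominationNumber≡ : Subgraph → ℕ → Set
  DominationNumber≡ H k =
    (∃ λ A → Dominating H A × ∣ A ∣ ≡ k)
    × (∀ A → Dominating H A → k ≤ ∣ A ∣)

-- A bridge block is dominated by either of its endpoints. Let H be a maximal 2-connected subgraph.
-- Adding to H an ear (a path of G between two vertices of H) keeps it 2-connected, so by maximality
-- every ear already lies in H; in particular H contains every common neighbour of two of its vertices.
-- Since V H is an arbitrary predicate, splitting on whether some vertex dominates H needs V H to be
-- decidable: it is the closure of two of its vertices under adding ears, found by breadth-first search.
-- If no vertex of G is equal or adjacent to every vertex of H, every cop position c has a
-- non-neighbour t ≠ c in H, and since H − c is connected the robber can always run inside H to such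
-- a t; the single cop then never catches her. A vertex equal or adjacent to all of H is either in H
-- or a common neighbour of two of its vertices, so it lies in H and dominates it.

module Submission where

open import Defs
open import Data.Nat using (ℕ; _≤_)
open import Data.Fin using (Fin; zero; _≟_)
open import Data.Fin.Properties using (any?; all?; ¬∀⟶∃¬)
open import Data.Fin.Subset using (Subset; ⁅_⁆; _∪_; _⊃_; ∣_∣) renaming (_∈_ to _∈ₛ_; _∉_ to _∉ₛ_)
open import Data.Fin.Subset.Properties using (_∈?_; x∈⁅x⁆; x∈⁅y⁆⇒x≡y; ∣⁅x⁆∣≡1; p⊆q⇒∣p∣≤∣q∣; p⊆p∪q; q⊆p∪q; x∈p∪q⁻)
open import Data.Fin.Subset.Induction using (⊃-wellFounded; Acc; acc)
open import Data.Bool.Properties using (T?)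
open import Data.List using (List; []; _∷_; _++_; [_])
open import Data.List.Membership.Propositional using (_∈_; _∉_)
open import Data.List.Membership.Propositional.Properties using (∈-++⁻)
open import Data.List.Relation.Unary.Any using (here; there)
open import Data.Vec using (_∷_; [])
open import Data.Vec.Membership.Propositional using () renaming (_∉_ to _∉ᵥ_)
open import Data.Vec.Relation.Unary.Any using () renaming (here to hereᵥ)
open import Data.Product using (Σ; ∃; ∃₂; _×_; _,_; proj₁; proj₂)
open import Data.Sum using (_⊎_; inj₁; inj₂; map₂)
open import Data.Unit using (⊤; tt)
open import Data.Empty using (⊥; ⊥-elim)
open import Function using (_∘_; id)
open import Relation.Nullary using (¬_; Dec; yes; no; ¬?)
open import Relation.Nullary.Decidable using (_×-dec_; map′)
open import Relation.Unary using (Decidable)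
open import Relation.Binary.PropositionalEquality using (_≡_; _≢_; refl; sym; subst)

module _ {n : ℕ} where

  x∈p∪⁅y⁆⁻ : ∀ {x w : Fin n} (K : Subset n) → x ∈ₛ K ∪ ⁅ w ⁆ → x ∈ₛ K ⊎ x ≡ w
  x∈p∪⁅y⁆⁻ {w = w} K x∈ with x∈p∪q⁻ K ⁅ w ⁆ x∈
  ... | inj₁ x∈K = inj₁ x∈K
  ... | inj₂ x∈⁅w⁆ = inj₂ (x∈⁅y⁆⇒x≡y w x∈⁅w⁆)

  x∈p⇒x∈p∪⁅y⁆ : ∀ {x w : Fin n} (K : Subset n) → x ∈ₛ K → x ∈ₛ K ∪ ⁅ w ⁆
  x∈p⇒x∈p∪⁅y⁆ {w = w} K = p⊆p∪q ⁅ w ⁆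

  y∈p∪⁅y⁆ : ∀ {w : Fin n} (K : Subset n) → w ∈ₛ K ∪ ⁅ w ⁆
  y∈p∪⁅y⁆ {w} K = q⊆p∪q K ⁅ w ⁆ (x∈⁅x⁆ w)

  x∈p⇒1≤∣p∣ : ∀ {x : Fin n} {A : Subset n} → x ∈ₛ A → 1 ≤ ∣ A ∣
  x∈p⇒1≤∣p∣ {x} {A} x∈A =
    subst (_≤ ∣ A ∣) (∣⁅x⁆∣≡1 x) (p⊆q⇒∣p∣≤∣q∣ λ y∈ → subst (_∈ₛ A) (sym (x∈⁅y⁆⇒x≡y x y∈)) x∈A)

  saturate : {Inv Done : Subset n → Set} →
             (∀ K → Inv K → Done K ⊎ ∃ λ w → w ∉ₛ K × Inv (K ∪ ⁅ w ⁆)) →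
             ∀ K → Inv K → ∃ λ K → Inv K × Done K
  saturate {Inv} {Done} grow K₀ = go K₀ (⊃-wellFounded K₀)
    where
    go : ∀ K → Acc _⊃_ K → Inv K → ∃ λ K → Inv K × Done K
    go K (acc larger) inv with grow K inv
    ... | inj₁ done = K , inv , done
    ... | inj₂ (w , w∉K , inv′) =
      go (K ∪ ⁅ w ⁆) (larger ((λ {_} → x∈p⇒x∈p∪⁅y⁆ K) , w , y∈p∪⁅y⁆ K , w∉K)) inv′

module _ {n : ℕ} (G : SimpleGraph n) where

  Adj-sym : ∀ {x y} → Adj G x y → Adj G y x
  Adj-sym = SimpleGraph.sym G _ _

  Adj-irrefl : ∀ {x y} → Adj G x y → x ≢ y
  Adj-irrefl {x} a refl = SimpleGraph.irrefl G x a

  whole : Subgraph G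
  whole = record
    { V = λ _ → ⊤ ; E = Adj G ; E-adj = id ; E-V = λ _ → tt , tt ; E-sym = Adj-sym }

  -- The vertex list is the index, so that distinctness can be stated.
  data SimplePath : Fin n → Fin n → List (Fin n) → Set where
    stop : ∀ x → SimplePath x x [ x ]
    edge : ∀ {x y t ys} → Adj G x y → x ∉ ys → SimplePath y t ys → SimplePath x t (x ∷ ys)

  data Traverses : ∀ {s t xs} → SimplePath s t xs → Fin n → Fin n → Set where
    first : ∀ {x y t ys} {a : Adj G x y} {x∉ : x ∉ ys} {P : SimplePath y t ys} →
            Traverses (edge a x∉ P) x y
    later : ∀ {x y t ys u v} {a : Adj G x y} {x∉ : x ∉ ys} {P : SimplePath y t ys} →
            Traverses P u v → Traverses (edge a x∉ P) u v

  start∈ : ∀ {s t xs} → SimplePath s t xs → s ∈ xs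
  start∈ (stop _) = here refl
  start∈ (edge _ _ _) = here refl

  end∈ : ∀ {s t xs} → SimplePath s t xs → t ∈ xs
  end∈ (stop _) = here refl
  end∈ (edge _ _ P) = there (end∈ P)

  Traverses-adj : ∀ {s t xs u v} {P : SimplePath s t xs} → Traverses P u v → Adj G u v
  Traverses-adj (first {a = a}) = a
  Traverses-adj (later tr) = Traverses-adj tr

  Traverses-∈ : ∀ {s t xs u v} {P : SimplePath s t xs} → Traverses P u v → u ∈ xs × v ∈ xs
  Traverses-∈ (first {P = P}) = here refl , there (start∈ P)
  Traverses-∈ (later tr) with Traverses-∈ tr
  ... | u∈ , v∈ = there u∈ , there v∈

  extend : ∀ {s x y xs} → SimplePath s x xs → Adj G x y → y ∉ xs → SimplePath s y (xs ++ [ y ])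
  extend (stop x) a y∉ = edge a (λ { (here refl) → y∉ (here refl) }) (stop _)
  extend {y = y} (edge {x = s} {ys = ys} a s∉ P) b y∉ = edge a s∉′ (extend P b (y∉ ∘ there))
    where
    s∉′ : s ∉ ys ++ [ y ]
    s∉′ m with ∈-++⁻ ys m
    ... | inj₁ m′ = s∉ m′
    ... | inj₂ (here refl) = y∉ (here refl)

  module _ {H : Subgraph G} {X : Fin n → Set} where

    HWalk-map : ∀ {H′ : Subgraph G} {u v} → (∀ {a b} → E H a b → E H′ a b) →
                HWalk G H X u v → HWalk G H′ X u v
    HWalk-map f here = here
    HWalk-map f (step e ¬X p) = step (f e) ¬X (HWalk-map f p)

    _++ʷ_ : ∀ {u v w} → HWalk G H X u v → HWalk G H X v w → HWalk G H X u w
    here ++ʷ q = q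
    step e ¬X p ++ʷ q = step e ¬X (p ++ʷ q)

    HWalk-reverse : ∀ {u v} → ¬ X u → HWalk G H X u v → HWalk G H X v u
    HWalk-reverse ¬Xu p = go ¬Xu p here
      where
      go : ∀ {s u v} → ¬ X u → HWalk G H X u v → HWalk G H X u s → HWalk G H X v s
      go ¬Xu here back = back
      go ¬Xu (step e ¬Xw p) back = go ¬Xw p (step (E-sym H e) ¬Xu back)

    walk-along : ∀ {s t xs x} (P : SimplePath s t xs) → (∀ {a b} → Traverses P a b → E H a b) →
                 (∀ {y} → y ∈ xs → ¬ X y) → x ∈ xs → HWalk G H X x t
    walk-along (stop _) emb ¬X (here refl) = here
    walk-along (edge _ _ P) emb ¬X (here refl) =
      step (emb first) (¬X (there (start∈ P))) (walk-along P (emb ∘ later) (¬X ∘ there) (start∈ P))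
    walk-along (edge _ _ P) emb ¬X (there x∈) = walk-along P (emb ∘ later) (¬X ∘ there) x∈

  walk-along-avoiding : ∀ {H : Subgraph G} {s t xs x} z (P : SimplePath s t xs) →
                        (∀ {a b} → Traverses P a b → E H a b) → x ∈ xs → x ≢ z →
                        (t ≢ z × HWalk G H (_≡ z) x t) ⊎ (s ≢ z × HWalk G H (_≡ z) x s)
  walk-along-avoiding z (stop _) _ (here refl) x≢z = inj₂ (x≢z , here)
  walk-along-avoiding z (edge _ _ _) _ (here refl) x≢z = inj₂ (x≢z , here)
  walk-along-avoiding {H} {s} z (edge a s∉ P) emb (there x∈) x≢z
    with walk-along-avoiding z P (emb ∘ later) x∈ x≢z
  ... | inj₁ forward = inj₁ forward
  ... | inj₂ (_ , back) with s ≟ z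
  ...   | no s≢z = inj₂ (s≢z , back ++ʷ step (E-sym H (emb first)) s≢z here)
  ...   | yes refl =
    inj₁ ( (λ { refl → s∉ (end∈ P) })
         , walk-along P (emb ∘ later) (λ y∈ y≡s → s∉ (subst (_∈ _) y≡s y∈)) x∈ )

  _∪ᵖ_ : ∀ {s t xs} → Subgraph G → SimplePath s t xs → Subgraph G
  _∪ᵖ_ {xs = xs} H P = record
    { V = λ x → V H x ⊎ x ∈ xs
    ; E = λ u v → E H u v ⊎ Traverses P u v ⊎ Traverses P v u
    ; E-adj = λ { (inj₁ e) → E-adj H e
                ; (inj₂ (inj₁ tr)) → Traverses-adj tr
                ; (inj₂ (inj₂ tr)) → Adj-sym (Traverses-adj tr) }
    ; E-V = λ { (inj₁ e) → inj₁ (proj₁ (E-V H e)) , inj₁ (proj₂ (E-V H e))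
              ; (inj₂ (inj₁ tr)) → inj₂ (proj₁ (Traverses-∈ tr)) , inj₂ (proj₂ (Traverses-∈ tr))
              ; (inj₂ (inj₂ tr)) → inj₂ (proj₂ (Traverses-∈ tr)) , inj₂ (proj₁ (Traverses-∈ tr)) }
    ; E-sym = λ { (inj₁ e) → inj₁ (E-sym H e)
                ; (inj₂ (inj₁ tr)) → inj₂ (inj₂ tr)
                ; (inj₂ (inj₂ tr)) → inj₂ (inj₁ tr) }
    }

  -- Every vertex of P reaches an endpoint of P along P, even avoiding z since z occurs on P at most once;
  -- walks in H then join the endpoints.
  ∪ᵖ-twoConnected : ∀ {H : Subgraph G} {s t xs} (P : SimplePath s t xs) →
                    TwoConnected G H → V H s → V H t → TwoConnected G (H ∪ᵖ P)
  ∪ᵖ-twoConnected {H} {s} {t} P ((a , b , c , Va , Vb , Vc , a≢b , a≢c , b≢c) , conn , conn-avoiding) Vs Vt =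
    (a , b , c , inj₁ Va , inj₁ Vb , inj₁ Vc , a≢b , a≢c , b≢c) , conn′ , conn-avoiding′
    where
    H′ = H ∪ᵖ P

    along : ∀ {u v} → Traverses P u v → E H′ u v
    along = inj₂ ∘ inj₁

    anchor : ∀ {x} → V H′ x → ∃ λ y → V H y × HWalk G H′ (λ _ → ⊥) x y
    anchor (inj₁ Vx) = _ , Vx , here
    anchor (inj₂ x∈) = t , Vt , walk-along P along (λ _ ()) x∈

    anchor-avoiding : ∀ {x} z → V H′ x → x ≢ z → ∃ λ y → V H y × y ≢ z × HWalk G H′ (_≡ z) x y
    anchor-avoiding z (inj₁ Vx) x≢z = _ , Vx , x≢z , here
    anchor-avoiding z (inj₂ x∈) x≢z with walk-along-avoiding z P along x∈ x≢z
    ... | inj₁ (t≢z , w) = t , Vt , t≢z , w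
    ... | inj₂ (s≢z , w) = s , Vs , s≢z , w

    conn′ : ∀ u v → V H′ u → V H′ v → HWalk G H′ (λ _ → ⊥) u v
    conn′ u v Vu Vv with anchor Vu | anchor Vv
    ... | u′ , Vu′ , wu | v′ , Vv′ , wv =
      wu ++ʷ (HWalk-map inj₁ (conn u′ v′ Vu′ Vv′) ++ʷ HWalk-reverse id wv)

    conn-avoiding′ : ∀ z u v → V H′ u → V H′ v → u ≢ z → v ≢ z → HWalk G H′ (_≡ z) u v
    conn-avoiding′ z u v Vu Vv u≢z v≢z with anchor-avoiding z Vu u≢z | anchor-avoiding z Vv v≢z
    ... | u′ , Vu′ , u′≢z , wu | v′ , Vv′ , v′≢z , wv =
      wu ++ʷ (HWalk-map inj₁ (conn-avoiding z u′ v′ Vu′ Vv′ u′≢z v′≢z) ++ʷ HWalk-reverse v≢z wv)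

  module _ {X : Fin n → Set} (X? : Decidable X) where

    private
      module BreadthFirstSearch {w} (¬Xw : ¬ X w) where
        Inv : Subset n → Set
        Inv R = w ∈ₛ R × (∀ {x} → x ∈ₛ R → ¬ X x)
                × (∀ {x} → x ∈ₛ R → ∃ λ xs → SimplePath w x xs × (∀ {y} → y ∈ xs → y ∈ₛ R))

        Done : Subset n → Set
        Done R = ∀ {x y} → x ∈ₛ R → y ∉ₛ R → ¬ X y → ¬ Adj G x y

        avoids₀ : ∀ {x} → x ∈ₛ ⁅ w ⁆ → ¬ X x
        avoids₀ x∈ rewrite x∈⁅y⁆⇒x≡y w x∈ = ¬Xw

        paths₀ : ∀ {x} → x ∈ₛ ⁅ w ⁆ → ∃ λ xs → SimplePath w x xs × (∀ {y} → y ∈ xs → y ∈ₛ ⁅ w ⁆)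
        paths₀ x∈ rewrite x∈⁅y⁆⇒x≡y w x∈ = [ w ] , stop w , λ { (here refl) → x∈⁅x⁆ w }

        grow : ∀ R → Inv R → Done R ⊎ ∃ λ y → y ∉ₛ R × Inv (R ∪ ⁅ y ⁆)
        grow R (w∈R , avoids , paths)
          with any? (λ x → any? (λ y → x ∈? R ×-dec ¬? (y ∈? R) ×-dec ¬? (X? y) ×-dec T? (SimpleGraph.adj G x y)))
        ... | no none = inj₁ λ x∈ y∉ ¬Xy a → none (_ , _ , x∈ , y∉ , ¬Xy , a)
        ... | yes (x , y , x∈ , y∉ , ¬Xy , a) = inj₂ (y , y∉ , x∈p⇒x∈p∪⁅y⁆ R w∈R , avoids′ , paths′)
          where
          avoids′ : ∀ {z} → z ∈ₛ R ∪ ⁅ y ⁆ → ¬ X z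
          avoids′ z∈ with x∈p∪⁅y⁆⁻ R z∈
          ... | inj₁ z∈R = avoids z∈R
          ... | inj₂ refl = ¬Xy

          paths′ : ∀ {z} → z ∈ₛ R ∪ ⁅ y ⁆ → ∃ λ xs → SimplePath w z xs × (∀ {v} → v ∈ xs → v ∈ₛ R ∪ ⁅ y ⁆)
          paths′ z∈ with x∈p∪⁅y⁆⁻ R z∈
          ... | inj₁ z∈R with paths z∈R
          ...   | xs , P , inR = xs , P , x∈p⇒x∈p∪⁅y⁆ R ∘ inR
          paths′ z∈ | inj₂ refl with paths x∈
          ...   | xs , P , inR = xs ++ [ y ] , extend P a (y∉ ∘ inR) , inR′
            where
            inR′ : ∀ {v} → v ∈ xs ++ [ y ] → v ∈ₛ R ∪ ⁅ y ⁆
            inR′ m with ∈-++⁻ xs m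
            ... | inj₁ m′ = x∈p⇒x∈p∪⁅y⁆ R (inR m′)
            ... | inj₂ (here refl) = y∈p∪⁅y⁆ R

        start : Inv ⁅ w ⁆
        start = x∈⁅x⁆ w , avoids₀ , paths₀

    reachable : ∀ {w} → ¬ X w → Σ (Subset n) λ R →
                (∀ {x} → x ∈ₛ R → ∃ λ xs → SimplePath w x xs × (∀ {y} → y ∈ xs → ¬ X y))
                × (∀ {x} → HWalk G whole X w x → x ∈ₛ R)
    reachable {w} ¬Xw with saturate (BreadthFirstSearch.grow ¬Xw) ⁅ w ⁆ (BreadthFirstSearch.start ¬Xw)
    ... | R , (w∈R , avoids , paths) , done = R , sound , complete w∈R
      where
      sound : ∀ {x} → x ∈ₛ R → ∃ λ xs → SimplePath w x xs × (∀ {y} → y ∈ xs → ¬ X y)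
      sound x∈ with paths x∈
      ... | xs , P , inR = xs , P , avoids ∘ inR

      complete : ∀ {x y} → x ∈ₛ R → HWalk G whole X x y → y ∈ₛ R
      complete x∈ here = x∈
      complete x∈ (step {w = y} a ¬Xy p) with y ∈? R
      ... | yes y∈ = complete y∈ p
      ... | no y∉ = ⊥-elim (done x∈ y∉ ¬Xy a)

    walk⇒simplePath : ∀ {w v} → ¬ X w → HWalk G whole X w v →
                      ∃ λ xs → SimplePath w v xs × (∀ {y} → y ∈ xs → ¬ X y)
    walk⇒simplePath ¬Xw p with reachable ¬Xw
    ... | _ , sound , complete = sound (complete p)

    walk? : ∀ {w} → ¬ X w → ∀ v → Dec (HWalk G whole X w v)
    walk? ¬Xw v with reachable ¬Xw
    ... | R , sound , complete = map′ toWalk complete (v ∈? R)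
      where
      toWalk : v ∈ₛ R → HWalk G whole X _ v
      toWalk v∈ with sound v∈
      ... | _ , P , avoids = walk-along P Traverses-adj avoids (start∈ P)

  Ear : Subset n → Fin n → Fin n → Set
  Ear K u w = u ∈ₛ K × w ∉ₛ K × Adj G u w × ∃ λ v → v ∈ₛ K × v ≢ u × HWalk G whole (_≡ u) w v

  ear? : ∀ K u w → Dec (Ear K u w)
  ear? K u w with u ∈? K | w ∈? K | T? (SimpleGraph.adj G u w)
  ... | no u∉ | _ | _ = no (u∉ ∘ proj₁)
  ... | yes _ | yes w∈ | _ = no λ (_ , w∉ , _) → w∉ w∈
  ... | yes _ | no _ | no ¬uw = no λ (_ , _ , uw , _) → ¬uw uw
  ... | yes u∈ | no w∉ | yes uw =
    map′ (λ back → u∈ , w∉ , uw , back) (λ (_ , _ , _ , back) → back)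
         (any? λ v → v ∈? K ×-dec ¬? (v ≟ u) ×-dec walk? (_≟ u) (λ { refl → w∉ u∈ }) v)

  exit-edge : ∀ {H : Subgraph G} {X : Fin n → Set} (K : Subset n) {s y} →
              HWalk G H X s y → s ∈ₛ K → y ∉ₛ K → ∃₂ λ u w → u ∈ₛ K × w ∉ₛ K × E H u w
  exit-edge K here s∈ y∉ = ⊥-elim (y∉ s∈)
  exit-edge K (step {w = w} e _ p) s∈ y∉ with w ∈? K
  ... | yes w∈ = exit-edge K p w∈ y∉
  ... | no w∉ = _ , w , s∈ , w∉ , e

  Hideout : (Fin n → Set) → Fin n → Set
  Hideout S c = ∃ λ t → S t × t ≢ c × ¬ Adj G c t

  hideout? : ∀ K → Decidable (Hideout (_∈ₛ K))
  hideout? K c = any? λ t → t ∈? K ×-dec ¬? (t ≟ c) ×-dec ¬? (T? (SimpleGraph.adj G c t))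

  dominator-or-hideouts : (K : Subset n) →
                          (∃ λ c → ∀ {y} → y ∈ₛ K → y ≡ c ⊎ Adj G c y) ⊎ (∀ c → Hideout (_∈ₛ K) c)
  dominator-or-hideouts K with all? (hideout? K)
  ... | yes hideout = inj₂ hideout
  ... | no ¬hideout with ¬∀⟶∃¬ n _ (hideout? K) ¬hideout
  ...   | c , none = inj₁ (c , universal)
    where
    universal : ∀ {y} → y ∈ₛ K → y ≡ c ⊎ Adj G c y
    universal {y} y∈ with y ≟ c | T? (SimpleGraph.adj G c y)
    ... | yes y≡c | _ = inj₁ y≡c
    ... | no _ | yes cy = inj₂ cy
    ... | no y≢c | no ¬cy = ⊥-elim (none (y , y∈ , y≢c , ¬cy))

  ∉-singleton : ∀ {x c : Fin n} → x ≢ c → x ∉ᵥ c ∷ []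
  ∉-singleton x≢c (hereᵥ x≡c) = x≢c x≡c

  HWalk⇒RobberPath : ∀ {H : Subgraph G} {c r t} → r ≢ c → HWalk G H (_≡ c) r t → RobberPath G (c ∷ []) r t
  HWalk⇒RobberPath r≢c here = stay
  HWalk⇒RobberPath {H} r≢c (step e w≢c p) =
    step (∉-singleton r≢c) (E-adj H e) (∉-singleton w≢c) (HWalk⇒RobberPath w≢c p)

  -- The robber always rests at a hideout of the cop's vertex, which the cop cannot reach in one move.
  module _ (S : Fin n → Set) (hideout : ∀ c → Hideout S c)
           (run : ∀ {c r t} → S r → S t → r ≢ c → t ≢ c → RobberPath G (c ∷ []) r t) where

    private
      survives-cops-turn : ∀ {c r} → S r → r ≢ c → ¬ Adj G c r → ¬ CopsWinFrom G (c ∷ []) r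
      survives-robbers-turn : ∀ {c r} → S r → r ≢ c → ¬ CopsWinAfterMove G (c ∷ []) r

      survives-cops-turn Sr r≢c _ (caught r∈) = ∉-singleton r≢c r∈
      survives-cops-turn {c} {r} Sr r≢c ¬cr (move {c' = c′ ∷ []} move-to next) =
        survives-robbers-turn Sr r≢c′ next
        where
        r≢c′ : r ≢ c′
        r≢c′ refl with move-to zero
        ... | inj₁ c≡r = r≢c (sym c≡r)
        ... | inj₂ cr = ¬cr cr

      survives-robbers-turn Sr r≢c (caught r∈) = ∉-singleton r≢c r∈
      survives-robbers-turn {c} Sr r≢c (respond escape) with hideout c
      ... | t , St , t≢c , ¬ct = survives-cops-turn St t≢c ¬ct (escape t (run Sr St r≢c t≢c))

    one-cop-loses : ¬ CopsWin G 1
    one-cop-loses (c ∷ [] , win) with hideout c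
    ... | t , St , t≢c , ¬ct = survives-cops-turn St t≢c ¬ct (win t)

  Dominates : Subgraph G → Fin n → Set
  Dominates H x = V H x × (∀ y → V H y → y ≡ x ⊎ E H y x)

  dominates⇒dominationNumber≡1 : ∀ {H x} → Dominates H x → DominationNumber≡ G H 1
  dominates⇒dominationNumber≡1 {H} {x} (Vx , dom) = (⁅ x ⁆ , (⊆H , dominating) , ∣⁅x⁆∣≡1 x) , atLeastOne
    where
    ⊆H : ∀ y → y ∈ₛ ⁅ x ⁆ → V H y
    ⊆H y y∈ rewrite x∈⁅y⁆⇒x≡y x y∈ = Vx

    dominating : ∀ y → V H y → y ∈ₛ ⁅ x ⁆ ⊎ ∃ λ z → z ∈ₛ ⁅ x ⁆ × E H y z
    dominating y Vy with dom y Vy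
    ... | inj₁ refl = inj₁ (x∈⁅x⁆ x)
    ... | inj₂ e = inj₂ (x , x∈⁅x⁆ x , e)

    atLeastOne : ∀ A → Dominating G H A → 1 ≤ ∣ A ∣
    atLeastOne A (_ , dominated) with dominated x Vx
    ... | inj₁ x∈A = x∈p⇒1≤∣p∣ x∈A
    ... | inj₂ (z , z∈A , _) = x∈p⇒1≤∣p∣ z∈A

  edge-dominated : ∀ {H u v} → IsEdge G H u v → Dominates H u
  edge-dominated {H} {u} {v} (_ , only-u-v , V-intro , _ , E-intro) = V-intro u (inj₁ refl) , dominated
    where
    dominated : ∀ y → V H y → y ≡ u ⊎ E H y u
    dominated y Vy with only-u-v y Vy
    ... | inj₁ y≡u = inj₁ y≡u
    ... | inj₂ refl = inj₂ (E-intro y u (inj₂ (refl , refl)))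

  module MaximalTwoConnected {H : Subgraph G} (H-2conn : TwoConnected G H)
                             (H-max : ∀ H′ → _⊑_ G H H′ → TwoConnected G H′ → _⊑_ G H′ H) where

    private
      connected : ∀ u v → V H u → V H v → HWalk G H (λ _ → ⊥) u v
      connected = proj₁ (proj₂ H-2conn)

      connected-avoiding : ∀ z u v → V H u → V H v → u ≢ z → v ≢ z → HWalk G H (_≡ z) u v
      connected-avoiding = proj₂ (proj₂ H-2conn)

    ear-absorbed : ∀ {s t xs} (P : SimplePath s t xs) → V H s → V H t →
                   (∀ {x} → x ∈ xs → V H x) × (∀ {u v} → Traverses P u v → E H u v)
    ear-absorbed P Vs Vt = (λ x∈ → proj₁ H∪P⊑H _ (inj₂ x∈)) , (λ tr → proj₂ H∪P⊑H _ _ (inj₂ (inj₁ tr)))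
      where
      H∪P⊑H : _⊑_ G (H ∪ᵖ P) H
      H∪P⊑H = H-max (H ∪ᵖ P) ((λ _ → inj₁) , (λ _ _ → inj₁)) (∪ᵖ-twoConnected P H-2conn Vs Vt)

    Adj⇒E : ∀ {x y} → V H x → V H y → Adj G x y → E H x y
    Adj⇒E Vx Vy xy = proj₂ (ear-absorbed (edge xy (λ { (here refl) → Adj-irrefl xy refl }) (stop _)) Vx Vy) first

    common-neighbour∈ : ∀ {x y c} → V H x → V H y → x ≢ y → Adj G x c → Adj G c y → V H c
    common-neighbour∈ {x} {y} {c} Vx Vy x≢y xc cy = proj₁ (ear-absorbed P Vx Vy) (there (here refl))
      where
      P : SimplePath x y (x ∷ c ∷ y ∷ [])
      P = edge xc (λ { (here refl) → Adj-irrefl xc refl ; (there (here refl)) → x≢y refl })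
               (edge cy (λ { (here refl) → Adj-irrefl cy refl }) (stop y))

    universal∈ : ∀ {a b c} → V H a → V H b → a ≢ b → (∀ {y} → V H y → y ≡ c ⊎ Adj G c y) → V H c
    universal∈ Va Vb a≢b universal with universal Va | universal Vb
    ... | inj₁ refl | _ = Va
    ... | _ | inj₁ refl = Vb
    ... | inj₂ ca | inj₂ cb = common-neighbour∈ Va Vb a≢b (Adj-sym ca) cb

    private
      module EarClosure {a b} (Va : V H a) (Vb : V H b) (a≢b : a ≢ b) where
        Inv : Subset n → Set
        Inv K = (∀ {x} → x ∈ₛ K → V H x) × a ∈ₛ K × b ∈ₛ K

        start : Inv (⁅ a ⁆ ∪ ⁅ b ⁆)
        start = ⊆H , x∈p⇒x∈p∪⁅y⁆ ⁅ a ⁆ (x∈⁅x⁆ a) , y∈p∪⁅y⁆ ⁅ a ⁆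
          where
          ⊆H : ∀ {x} → x ∈ₛ ⁅ a ⁆ ∪ ⁅ b ⁆ → V H x
          ⊆H x∈ with x∈p∪⁅y⁆⁻ ⁅ a ⁆ x∈
          ... | inj₁ x∈⁅a⁆ rewrite x∈⁅y⁆⇒x≡y a x∈⁅a⁆ = Va
          ... | inj₂ refl = Vb

        grow : ∀ K → Inv K → (∀ u w → ¬ Ear K u w) ⊎ ∃ λ w → w ∉ₛ K × Inv (K ∪ ⁅ w ⁆)
        grow K (⊆H , a∈ , b∈) with any? (λ u → any? (λ w → ear? K u w))
        ... | no none = inj₁ λ u w ear → none (u , w , ear)
        ... | yes (u , w , u∈ , w∉ , uw , v , v∈ , _ , back)
          with walk⇒simplePath (_≟ u) (λ { refl → w∉ u∈ }) back
        ...   | xs , P , avoids-u = inj₂ (w , w∉ , ⊆H′ , x∈p⇒x∈p∪⁅y⁆ K a∈ , x∈p⇒x∈p∪⁅y⁆ K b∈)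
          where
          Vw : V H w
          Vw = proj₁ (ear-absorbed (edge uw (λ u∈xs → avoids-u u∈xs refl) P) (⊆H u∈) (⊆H v∈))
                     (there (start∈ P))

          ⊆H′ : ∀ {x} → x ∈ₛ K ∪ ⁅ w ⁆ → V H x
          ⊆H′ x∈ with x∈p∪⁅y⁆⁻ K x∈
          ... | inj₁ x∈K = ⊆H x∈K
          ... | inj₂ refl = Vw

    -- K is the closure of {a, b} under ears; a vertex of H outside K would give an ear of K through the
    -- first edge of H leaving K, returning to whichever of a, b differs from its start.
    vertices-decidable : Σ (Subset n) λ K → (∀ {x} → x ∈ₛ K → V H x) × (∀ {x} → V H x → x ∈ₛ K)
    vertices-decidable with proj₁ H-2conn
    ... | a , b , _ , Va , Vb , _ , a≢b , _
      with saturate (EarClosure.grow Va Vb a≢b) (⁅ a ⁆ ∪ ⁅ b ⁆) (EarClosure.start Va Vb a≢b)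
    ...   | K , (⊆H , a∈ , b∈) , closed = K , ⊆H , H⊆
      where
      other-than : ∀ u → ∃ λ v → v ∈ₛ K × v ≢ u
      other-than u with u ≟ a
      ... | yes refl = b , b∈ , a≢b ∘ sym
      ... | no u≢a = a , a∈ , u≢a ∘ sym

      H⊆ : ∀ {y} → V H y → y ∈ₛ K
      H⊆ {y} Vy with y ∈? K
      ... | yes y∈ = y∈
      ... | no y∉ with exit-edge K (connected a y Va Vy) a∈ y∉
      ...   | u , w , u∈ , w∉ , uw with other-than u
      ...     | v , v∈ , v≢u = ⊥-elim (closed u w (u∈ , w∉ , E-adj H uw , v , v∈ , v≢u , back))
        where
        back : HWalk G whole (_≡ u) w v
        back = HWalk-map (E-adj H)
                 (connected-avoiding u w v (proj₂ (E-V H uw)) (⊆H v∈) (λ { refl → w∉ u∈ }) v≢u)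

    cop-win⇒dominated : CopsWin G 1 → ∃ (Dominates H)
    cop-win⇒dominated cop-win with proj₁ H-2conn | vertices-decidable
    ... | a , b , _ , Va , Vb , _ , a≢b , _ | K , ⊆H , H⊆ with dominator-or-hideouts K
    ...   | inj₂ hideout = ⊥-elim (one-cop-loses (V H) hideoutᴴ run cop-win)
      where
      hideoutᴴ : ∀ c → Hideout (V H) c
      hideoutᴴ c with hideout c
      ... | t , t∈ , t≢c , ¬ct = t , ⊆H t∈ , t≢c , ¬ct

      run : ∀ {c r t} → V H r → V H t → r ≢ c → t ≢ c → RobberPath G (c ∷ []) r t
      run Vr Vt r≢c t≢c = HWalk⇒RobberPath r≢c (connected-avoiding _ _ _ Vr Vt r≢c t≢c)
    ...   | inj₁ (c , universalᴷ) = c , Vc , λ y Vy → map₂ (Adj⇒E Vy Vc ∘ Adj-sym) (universal Vy)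
      where
      universal : ∀ {y} → V H y → y ≡ c ⊎ Adj G c y
      universal = universalᴷ ∘ H⊆

      Vc : V H c
      Vc = universal∈ Va Vb a≢b universal

lemma2p2 : ∀ {n : ℕ} (G : SimpleGraph n) → Connected G → CopNumberInf≡ G 1
         → ∀ (H : Subgraph G) → Block G H → DominationNumber≡ G H 1
lemma2p2 G _ (cop-win , _) H (inj₁ (H-2conn , H-max)) =
  dominates⇒dominationNumber≡1 G {H} (proj₂ (MaximalTwoConnected.cop-win⇒dominated G H-2conn H-max cop-win))
lemma2p2 G _ _ H (inj₂ (_ , _ , H-edge , _)) = dominates⇒dominationNumber≡1 G {H} (edge-dominated G {H} H-edge)
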